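{- For every integer $\Delta\geq2$, there exist graphs $G_1,G_2$ such that $\Delta(G_1)=\chi'(G_1)=\Delta$, $\Delta(G_2)=\chi'(G_2)=\Delta$, and $G_1\cup G_2$ is bipartite, but $\chi'(G_1,G_2)\geq\Delta+1$.
   Context: $\chi'(G)$ is the chromatic index. For graphs $G_1,G_2$ (possibly sharing edges), $\chi'(G_1,G_2)$ is the least number of colours in an edge-colouring of $G_1\cup G_2$ whose restriction to each of $G_1$ and $G_2$ is proper. -}

module Defs where

open import Data.Nat using (ℕ; _<_; _≤_; _⊔_)
open import Data.Fin using (Fin)
open import Data.Bool using (Bool; true; false; if_then_else_; _∨_)
open import Data.List using (List; map; foldr; allFin)
open import Data.Nat.ListAction using (sum)
open import Data.Product using (Σ; ∃; _×_)
open import Relation.Binary.PropositionalEquality using (_≡_; _≢_; cong₂)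
open import Relation.Nullary using (¬_)

record Graph (n : ℕ) : Set where
  field
    adj     : Fin n → Fin n → Bool
    adj-sym : ∀ u v → adj u v ≡ adj v u
    irrefl  : ∀ u → adj u u ≡ false
open Graph public

degree : ∀ {n} → Graph n → Fin n → ℕ
degree {n} G u = sum (map (λ v → if adj G u v then 1 else 0) (allFin n))

maxDegree : ∀ {n} → Graph n → ℕ
maxDegree {n} G = foldr _⊔_ 0 (map (degree G) (allFin n))

_∪ᴳ_ : ∀ {n} → Graph n → Graph n → Graph n
_∪ᴳ_ {n} G H = record
  { adj = λ u v → adj G u v ∨ adj H u v
  ; adj-sym = λ u v → lemma u v
  ; irrefl = λ u → lemma2 u }
  where
  lemma : ∀ u v → (adj G u v ∨ adj H u v) ≡ (adj G v u ∨ adj H v u)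
  lemma u v = cong₂ _∨_ (adj-sym G u v) (adj-sym H u v)
  lemma2 : ∀ u → (adj G u u ∨ adj H u u) ≡ false
  lemma2 u = cong₂ _∨_ (irrefl G u) (irrefl H u)

-- An edge-colouring c of G with k colours is a colour for every edge,
-- encoded as a function on vertex pairs which is symmetric on edges.
ProperOn : ∀ {n k} → Graph n → (Fin n → Fin n → Fin k) → Set
ProperOn G c = ∀ u v w → adj G u v ≡ true → adj G u w ≡ true → v ≢ w → c u v ≢ c u w

-- χ'(G₁,G₂) ≤ k : there is a k-edge-colouring of G₁ ∪ G₂ whose restrictions
-- to G₁ and to G₂ are both proper.
Colourable₂ : ∀ {n} → Graph n → Graph n → ℕ → Set
Colourable₂ {n} G₁ G₂ k =
  Σ (Fin n → Fin n → Fin k) λ c →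
    (∀ u v → adj (G₁ ∪ᴳ G₂) u v ≡ true → c u v ≡ c v u)
    × ProperOn G₁ c × ProperOn G₂ c

Colourable : ∀ {n} → Graph n → ℕ → Set
Colourable {n} G k =
  Σ (Fin n → Fin n → Fin k) λ c →
    (∀ u v → adj G u v ≡ true → c u v ≡ c v u) × ProperOn G c

ChromaticIndex : ∀ {n} → Graph n → ℕ → Set
ChromaticIndex G k = Colourable G k × (∀ m → m < k → ¬ Colourable G m)

ChromaticIndex₂≥ : ∀ {n} → Graph n → Graph n → ℕ → Set
ChromaticIndex₂≥ G₁ G₂ k = ∀ m → m < k → ¬ Colourable₂ G₁ G₂ m

Bipartite : ∀ {n} → Graph n → Set
Bipartite {n} G = Σ (Fin n → Bool) λ side → ∀ u v → adj G u v ≡ true → side u ≢ side v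

-- Write Δ = m + 2. A gadget is a vertex u with Δ − 1 neighbours common to G₁ and G₂,
-- plus one more neighbour e in G₁ and f in G₂: in a joint colouring with at most Δ
-- colours the common edges at u use up Δ − 1 colours, so ue and uf get the remaining one.
-- Gadgets at b, pₖ and qₖ force φ(ab) = φ(xb) and φ(apₖ) = φ(pₖqₖ) = φ(qₖy).
-- In G₁ the vertex y has the Δ neighbours x, a, qₖ, and φ(ab) differs from the colours
-- of all of them (of xy by properness of G₂ at x, of ya and yqₖ by properness of G₁
-- at a), so a joint colouring needs Δ + 1 colours. Each Gᵢ alone has an explicit
-- Δ-edge-colouring, in which every vertex recovers its neighbours from the colours,
-- and a vertex b of degree Δ; all edges of both graphs cross one bipartition.
module Submission where

open import Defs
open import Data.Bool using (Bool; true; false; if_then_else_; _∨_)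
open import Data.Bool.Properties using (∨-zeroʳ)
open import Data.Empty using (⊥; ⊥-elim)
open import Data.Fin using (Fin; zero; suc; _≟_; punchIn)
open import Data.Fin.Properties using (suc-injective; injective⇒≤; <⇒notInjective; +↔⊎; *↔×)
open import Data.List using (map; allFin; tabulate)
open import Data.List.Membership.Propositional.Properties using (∈-map⁺; ∈-allFin)
open import Data.List.Properties using (map-tabulate; foldr-preservesᵇ; foldr-preservesᵒ)
open import Data.List.Relation.Unary.All.Properties using (tabulate⁺; map⁺)
open import Data.List.Relation.Unary.Any as Any using ()
open import Data.Nat using (ℕ; suc; _+_; _*_; _≤_; _<_; _⊔_; z≤n; s≤s)
open import Data.Nat.ListAction using (sum)
open import Data.Nat.Properties using (≤-antisym; ≤-refl; ≤-trans; ⊔-lub; m≤n⇒m≤n⊔o; m≤n⇒m≤o⊔n)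
open import Data.Product using (Σ; ∃; _×_; _,_; proj₁; proj₂)
open import Data.Sum using (_⊎_; inj₁; inj₂; [_,_]′)
open import Data.Sum.Function.Propositional using (_⊎-↔_)
open import Data.Sum.Properties using (inj₁-injective; inj₂-injective)
open import Data.Vec.Functional using (_∷_; insertAt)
open import Data.Vec.Functional.Properties using (insertAt-lookup; insertAt-punchIn)
open import Function using (_∘_; id; const)
open import Function.Bundles using (_↔_; Inverse; Injection)
open import Function.Definitions using (Injective)
open import Function.Properties.Inverse using (↔⇒↣; ↔-sym; ↔-refl; ↔-trans)
open import Level using (0ℓ)
open import Relation.Binary using (REL; Decidable)
open import Relation.Binary.PropositionalEquality using (_≡_; _≢_; refl; sym; trans; cong; module ≡-Reasoning)
open import Relation.Nullary using (¬_; yes; no; contradiction)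
open import Relation.Nullary.Decidable using (does; dec-true; map′)

open ≡-Reasoning

count : ∀ {n} → (Fin n → Bool) → ℕ
count P = sum (tabulate (λ v → if P v then 1 else 0))

enumerate : ∀ {n} (P : Fin n → Bool) → Fin (count P) → Fin n
enumerate {suc n} P i with P zero
enumerate {suc n} P zero    | true  = zero
enumerate {suc n} P (suc i) | true  = suc (enumerate (P ∘ suc) i)
enumerate {suc n} P i       | false = suc (enumerate (P ∘ suc) i)

enumerate-sound : ∀ {n} (P : Fin n → Bool) i → P (enumerate P i) ≡ true
enumerate-sound {suc n} P i with P zero in P₀
enumerate-sound {suc n} P zero    | true  = P₀
enumerate-sound {suc n} P (suc i) | true  = enumerate-sound (P ∘ suc) i
enumerate-sound {suc n} P i       | false = enumerate-sound (P ∘ suc) i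

enumerate-injective : ∀ {n} (P : Fin n → Bool) → Injective _≡_ _≡_ (enumerate P)
enumerate-injective {suc n} P {i} {j} eq with P zero
enumerate-injective {suc n} P {zero}  {zero}  eq | true  = refl
enumerate-injective {suc n} P {suc i} {suc j} eq | true  =
  cong suc (enumerate-injective (P ∘ suc) (suc-injective eq))
enumerate-injective {suc n} P {i}     {j}     eq | false =
  enumerate-injective (P ∘ suc) (suc-injective eq)

enumerate-complete : ∀ {n} (P : Fin n → Bool) {v} → P v ≡ true → ∃ λ i → enumerate P i ≡ v
enumerate-complete {suc n} P {v} Pv with P zero in P₀
enumerate-complete {suc n} P {zero}  Pv | true  = zero , refl
enumerate-complete {suc n} P {suc v} Pv | true  with enumerate-complete (P ∘ suc) Pv
... | i , eq = suc i , cong suc eq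
enumerate-complete {suc n} P {zero}  Pv | false = contradiction (trans (sym Pv) P₀) λ ()
enumerate-complete {suc n} P {suc v} Pv | false with enumerate-complete (P ∘ suc) Pv
... | i , eq = i , cong suc eq

count-≤ : ∀ {n k} (P : Fin n → Bool) (f : Fin n → Fin k) →
          (∀ {v w} → P v ≡ true → P w ≡ true → f v ≡ f w → v ≡ w) → count P ≤ k
count-≤ P f f-injective =
  injective⇒≤ (enumerate-injective P ∘ f-injective (enumerate-sound P _) (enumerate-sound P _))

≤-count : ∀ {n k} (P : Fin n → Bool) (g : Fin k → Fin n) →
          Injective _≡_ _≡_ g → (∀ i → P (g i) ≡ true) → k ≤ count P
≤-count {k = k} P g g-injective Pg = injective⇒≤ position-injective
  where
  position : Fin k → Fin (count P)
  position i = proj₁ (enumerate-complete P (Pg i))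

  enumerate-position : ∀ i → enumerate P (position i) ≡ g i
  enumerate-position i = proj₂ (enumerate-complete P (Pg i))

  position-injective : Injective _≡_ _≡_ position
  position-injective {i} {j} eq = g-injective (begin
    g i                       ≡⟨ enumerate-position i ⟨
    enumerate P (position i)  ≡⟨ cong (enumerate P) eq ⟩
    enumerate P (position j)  ≡⟨ enumerate-position j ⟩
    g j                       ∎)

degree≡count : ∀ {n} (G : Graph n) u → degree G u ≡ count (adj G u)
degree≡count G u = cong sum (map-tabulate id (λ v → if adj G u v then 1 else 0))

record Star {n} (G : Graph n) (u : Fin n) (k : ℕ) : Set where
  field
    leaf           : Fin k → Fin n
    leaf-adj       : ∀ i → adj G u (leaf i) ≡ true
    leaf-injective : Injective _≡_ _≡_ leaf
open Star

star⇒≤degree : ∀ {n k} {G : Graph n} {u} → Star G u k → k ≤ degree G u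
star⇒≤degree {G = G} {u} s rewrite degree≡count G u =
  ≤-count (adj G u) (leaf s) (leaf-injective s) (leaf-adj s)

proper⇒degree≤ : ∀ {n k} {G : Graph n} {c : Fin n → Fin n → Fin k} →
                 ProperOn G c → ∀ u → degree G u ≤ k
proper⇒degree≤ {G = G} {c} proper u rewrite degree≡count G u = count-≤ (adj G u) (c u) injective
  where
  injective : ∀ {v w} → adj G u v ≡ true → adj G u w ≡ true → c u v ≡ c u w → v ≡ w
  injective {v} {w} uv uw same with v ≟ w
  ... | yes v≡w = v≡w
  ... | no v≢w  = contradiction same (proper u v w uv uw v≢w)

degrees≤⇒maxDegree≤ : ∀ {n k} (G : Graph n) → (∀ u → degree G u ≤ k) → maxDegree G ≤ k
degrees≤⇒maxDegree≤ {k = k} G deg≤ =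
  foldr-preservesᵇ {P = _≤ k} ⊔-lub z≤n (map⁺ (tabulate⁺ deg≤))

degree≤maxDegree : ∀ {n} (G : Graph n) u → degree G u ≤ maxDegree G
degree≤maxDegree {n} G u = foldr-preservesᵒ bound 0 (map (degree G) (allFin n))
  (inj₂ (Any.map (λ { refl → ≤-refl }) (∈-map⁺ (degree G) (∈-allFin u))))
  where
  bound : ∀ x y → degree G u ≤ x ⊎ degree G u ≤ y → degree G u ≤ x ⊔ y
  bound x y = [ m≤n⇒m≤n⊔o y , m≤n⇒m≤o⊔n x ]′

star-colours-injective : ∀ {n k d} {G : Graph n} {c : Fin n → Fin n → Fin k} {u} →
                         ProperOn G c → (s : Star G u d) → Injective _≡_ _≡_ (c u ∘ leaf s)
star-colours-injective {u = u} proper s {i} {j} same with i ≟ j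
... | yes i≡j = i≡j
... | no i≢j  = contradiction same
  (proper u (leaf s i) (leaf s j) (leaf-adj s i) (leaf-adj s j) (i≢j ∘ leaf-injective s))

star⇒¬colourable : ∀ {n k m} {G : Graph n} {u} → Star G u k → m < k → ¬ Colourable G m
star⇒¬colourable s m<k (_ , _ , proper) = <⇒notInjective m<k (star-colours-injective proper s)

colourable∧star⇒maxDegree≡ : ∀ {n k} {G : Graph n} {u} → Colourable G k → Star G u k →
                             maxDegree G ≡ k
colourable∧star⇒maxDegree≡ {G = G} {u} (_ , _ , proper) s = ≤-antisym
  (degrees≤⇒maxDegree≤ G (proper⇒degree≤ {G = G} proper))
  (≤-trans (star⇒≤degree s) (degree≤maxDegree G u))

colourable∧star⇒chromaticIndex : ∀ {n k} {G : Graph n} {u} → Colourable G k → Star G u k →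
                                 ChromaticIndex G k
colourable∧star⇒chromaticIndex colourable s = colourable , λ m m<k → star⇒¬colourable s m<k

fresh-∷-injective : ∀ {A : Set} {k} {x : A} {f : Fin k → A} →
                    (∀ i → x ≢ f i) → Injective _≡_ _≡_ f → Injective _≡_ _≡_ (x ∷ f)
fresh-∷-injective fresh f-injective {zero}  {zero}  eq = refl
fresh-∷-injective fresh f-injective {zero}  {suc j} eq = contradiction eq (fresh j)
fresh-∷-injective fresh f-injective {suc i} {zero}  eq = contradiction (sym eq) (fresh i)
fresh-∷-injective fresh f-injective {suc i} {suc j} eq = cong suc (f-injective eq)

decoder⇒proper : ∀ {n k} {G : Graph n} {c : Fin n → Fin n → Fin k} (decode : Fin n → Fin k → Fin n) →
                 (∀ u v → adj G u v ≡ true → decode u (c u v) ≡ v) → ProperOn G c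
decoder⇒proper decode decodes u v w uv uw v≢w same =
  v≢w (trans (sym (decodes u v uv)) (trans (cong (decode u) same) (decodes u w uw)))

Separates : ∀ {n} → (Fin n → Bool) → Graph n → Set
Separates side G = ∀ u v → adj G u v ≡ true → side u ≢ side v

module _ {n} (G₁ G₂ : Graph n) where

  ∪-adjˡ : ∀ {u v} → adj G₁ u v ≡ true → adj (G₁ ∪ᴳ G₂) u v ≡ true
  ∪-adjˡ {u} {v} uv = cong (_∨ adj G₂ u v) uv

  ∪-adjʳ : ∀ {u v} → adj G₂ u v ≡ true → adj (G₁ ∪ᴳ G₂) u v ≡ true
  ∪-adjʳ {u} {v} uv = trans (cong (adj G₁ u v ∨_) uv) (∨-zeroʳ (adj G₁ u v))

  ∪-bipartite : ∀ side → Separates side G₁ → Separates side G₂ → Bipartite (G₁ ∪ᴳ G₂)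
  ∪-bipartite side separates₁ separates₂ = side , separates
    where
    separates : Separates side (G₁ ∪ᴳ G₂)
    separates u v uv with adj G₁ u v in uv₁
    ... | true  = separates₁ u v uv₁
    ... | false = separates₂ u v uv

  gadget⇒same-colour : ∀ {k d u e f} {c : Fin n → Fin n → Fin k} → ProperOn G₁ c → ProperOn G₂ c →
                       k < suc (suc d) → (s : Star G₁ u d) → (∀ i → adj G₂ u (leaf s i) ≡ true) →
                       adj G₁ u e ≡ true → adj G₂ u f ≡ true →
                       (∀ i → e ≢ leaf s i) → (∀ i → f ≢ leaf s i) →
                       c u e ≡ c u f
  gadget⇒same-colour {u = u} {e} {f} {c} proper₁ proper₂ k<2+d s leaf-adj₂ ue uf e∉s f∉s
    with c u e ≟ c u f
  ... | yes same  = same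
  ... | no differ = ⊥-elim (<⇒notInjective k<2+d
    (fresh-∷-injective fresh-e (fresh-∷-injective fresh-f (star-colours-injective proper₁ s))))
    where
    fresh-f : ∀ i → c u f ≢ c u (leaf s i)
    fresh-f i = proper₂ u f (leaf s i) uf (leaf-adj₂ i) (f∉s i)

    fresh-e : ∀ i → c u e ≢ (c u f ∷ c u ∘ leaf s) i
    fresh-e zero    = differ
    fresh-e (suc i) = proper₁ u e (leaf s i) ue (leaf-adj s i) (e∉s i)

module BipartiteGraph {n} {L R : Set} (parts : Fin n ↔ (L ⊎ R)) where
  open Inverse parts using (to; from; strictlyInverseˡ; strictlyInverseʳ)

  left : L → Fin n
  left = from ∘ inj₁

  right : R → Fin n
  right = from ∘ inj₂

  from-injective : Injective _≡_ _≡_ from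
  from-injective = Injection.injective (↔⇒↣ (↔-sym parts))

  left-injective : Injective _≡_ _≡_ left
  left-injective = inj₁-injective ∘ from-injective

  right-injective : Injective _≡_ _≡_ right
  right-injective = inj₂-injective ∘ from-injective

  left-≢ : ∀ {l l′} → l ≢ l′ → left l ≢ left l′
  left-≢ l≢l′ = l≢l′ ∘ left-injective

  right-≢ : ∀ {r r′} → r ≢ r′ → right r ≢ right r′
  right-≢ r≢r′ = r≢r′ ∘ right-injective

  side : Fin n → Bool
  side u = [ (λ _ → true) , (λ _ → false) ]′ (to u)

  -- The value on pairs from the same side is irrelevant: they are never adjacent.
  colourᵛ : ∀ {k} → (L → R → Fin (suc k)) → L ⊎ R → L ⊎ R → Fin (suc k)
  colourᵛ col (inj₁ l) (inj₂ r) = col l r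
  colourᵛ col (inj₂ r) (inj₁ l) = col l r
  colourᵛ col _        _        = zero

  colourᵛ-sym : ∀ {k} (col : L → R → Fin (suc k)) p q → colourᵛ col p q ≡ colourᵛ col q p
  colourᵛ-sym col (inj₁ _) (inj₁ _) = refl
  colourᵛ-sym col (inj₁ _) (inj₂ _) = refl
  colourᵛ-sym col (inj₂ _) (inj₁ _) = refl
  colourᵛ-sym col (inj₂ _) (inj₂ _) = refl

  decodeᵛ : ∀ {k} → (L → Fin k → R) → (R → Fin k → L) → L ⊎ R → Fin k → L ⊎ R
  decodeᵛ neighbourᴸ neighbourᴿ (inj₁ l) t = inj₂ (neighbourᴸ l t)
  decodeᵛ neighbourᴸ neighbourᴿ (inj₂ r) t = inj₁ (neighbourᴿ r t)

  module _ {E : REL L R 0ℓ} (E? : Decidable E) where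

    between : L ⊎ R → L ⊎ R → Bool
    between (inj₁ l) (inj₂ r) = does (E? l r)
    between (inj₂ r) (inj₁ l) = does (E? l r)
    between _        _        = false

    between-sym : ∀ p q → between p q ≡ between q p
    between-sym (inj₁ _) (inj₁ _) = refl
    between-sym (inj₁ _) (inj₂ _) = refl
    between-sym (inj₂ _) (inj₁ _) = refl
    between-sym (inj₂ _) (inj₂ _) = refl

    between-irrefl : ∀ p → between p p ≡ false
    between-irrefl (inj₁ _) = refl
    between-irrefl (inj₂ _) = refl

    graph : Graph n
    graph = record
      { adj     = λ u v → between (to u) (to v)
      ; adj-sym = λ u v → between-sym (to u) (to v)
      ; irrefl  = λ u → between-irrefl (to u)
      }

    edge : ∀ {l r} → E l r → adj graph (left l) (right r) ≡ true
    edge {l} {r} e rewrite strictlyInverseˡ (inj₁ l) | strictlyInverseˡ (inj₂ r) = dec-true (E? l r) e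

    edgeʳ : ∀ {l r} → E l r → adj graph (right r) (left l) ≡ true
    edgeʳ {l} {r} e = trans (adj-sym graph (right r) (left l)) (edge e)

    graph-separates : Separates side graph
    graph-separates u v uv with to u | to v
    graph-separates u v uv | inj₁ _ | inj₂ _ = λ ()
    graph-separates u v uv | inj₂ _ | inj₁ _ = λ ()
    graph-separates u v () | inj₁ _ | inj₁ _
    graph-separates u v () | inj₂ _ | inj₂ _

    graph-colourable : ∀ {k} (col : L → R → Fin (suc k))
                       (neighbourᴸ : L → Fin (suc k) → R) (neighbourᴿ : R → Fin (suc k) → L) →
                       (∀ {l r} → E l r →
                          neighbourᴸ l (col l r) ≡ r × neighbourᴿ r (col l r) ≡ l) →
                       Colourable graph (suc k)
    graph-colourable {k} col neighbourᴸ neighbourᴿ decodes =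
      colouring , (λ u v _ → colourᵛ-sym col (to u) (to v)) ,
      decoder⇒proper {G = graph} decode decode-correct
      where
      colouring : Fin n → Fin n → Fin (suc k)
      colouring u v = colourᵛ col (to u) (to v)

      decode : Fin n → Fin (suc k) → Fin n
      decode u t = from (decodeᵛ neighbourᴸ neighbourᴿ (to u) t)

      decodeᵛ-correct : ∀ p q → between p q ≡ true →
                        decodeᵛ neighbourᴸ neighbourᴿ p (colourᵛ col p q) ≡ q
      decodeᵛ-correct (inj₁ l) (inj₂ r) pq with E? l r
      decodeᵛ-correct (inj₁ l) (inj₂ r) pq | yes e = cong inj₂ (proj₁ (decodes e))
      decodeᵛ-correct (inj₁ l) (inj₂ r) () | no _
      decodeᵛ-correct (inj₂ r) (inj₁ l) pq with E? l r
      decodeᵛ-correct (inj₂ r) (inj₁ l) pq | yes e = cong inj₁ (proj₂ (decodes e))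
      decodeᵛ-correct (inj₂ r) (inj₁ l) () | no _

      decode-correct : ∀ u v → adj graph u v ≡ true → decode u (colouring u v) ≡ v
      decode-correct u v uv = trans (cong from (decodeᵛ-correct (to u) (to v) uv)) (strictlyInverseʳ v)

    left-star : ∀ {d r} (nb : Fin d → L) → Injective _≡_ _≡_ nb → (∀ i → E (nb i) r) →
                Star graph (right r) d
    left-star nb nb-injective e = record
      { leaf = left ∘ nb ; leaf-adj = edgeʳ ∘ e ; leaf-injective = nb-injective ∘ left-injective }

    right-star : ∀ {d l} (nb : Fin d → R) → Injective _≡_ _≡_ nb → (∀ i → E l (nb i)) →
                 Star graph (left l) d
    right-star nb nb-injective e = record
      { leaf = right ∘ nb ; leaf-adj = edge ∘ e ; leaf-injective = nb-injective ∘ right-injective }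

    saturated-star : ∀ {k r} (col : L → R → Fin k) (nb : Fin k → L) →
                     (∀ t → E (nb t) r × col (nb t) r ≡ t) → Star graph (right r) k
    saturated-star {r = r} col nb saturated = left-star nb nb-injective (proj₁ ∘ saturated)
      where
      nb-injective : Injective _≡_ _≡_ nb
      nb-injective {s} {t} eq = begin
        s               ≡⟨ proj₂ (saturated s) ⟨
        col (nb s) r    ≡⟨ cong (λ l → col l r) eq ⟩
        col (nb t) r    ≡⟨ proj₂ (saturated t) ⟩
        t               ∎

+↔Fin⊎ : ∀ {k l} {B : Set} → Fin l ↔ B → Fin (k + l) ↔ (Fin k ⊎ B)
+↔Fin⊎ f = ↔-trans +↔⊎ (↔-refl ⊎-↔ f)

module Construction (m : ℕ) where

  Δ : ℕ
  Δ = suc (suc m)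

  -- The two sides of the bipartition, as sums of Fin types so that their enumeration
  -- comes from library bijections. The patterns of the right side reuse the shapes of
  -- those of the left side (a and b are both inj₁ zero); the type tells them apart.
  Left Right : Set
  Left  = Fin 2 ⊎ Fin (suc m) ⊎ Fin m ⊎ Fin m × Fin (suc m)
  Right = Fin 2 ⊎ Fin m ⊎ Fin m × Fin (suc m)

  pattern a      = inj₁ zero
  pattern x      = inj₁ (suc zero)
  pattern c j    = inj₂ (inj₁ j)
  pattern q k    = inj₂ (inj₂ (inj₁ k))
  pattern lp k j = inj₂ (inj₂ (inj₂ (k , j)))

  pattern b      = inj₁ zero
  pattern y      = inj₁ (suc zero)
  pattern p k    = inj₂ (inj₁ k)
  pattern lq k j = inj₂ (inj₂ (k , j))

  n : ℕ
  n = (2 + (suc m + (m + m * suc m))) + (2 + (m + m * suc m))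

  -- Opaque so that left l and right r stay rigid and Agda can infer l and r from them.
  opaque
    parts : Fin n ↔ (Left ⊎ Right)
    parts = ↔-trans +↔⊎ (+↔Fin⊎ (+↔Fin⊎ (+↔Fin⊎ *↔×)) ⊎-↔ +↔Fin⊎ (+↔Fin⊎ *↔×))

  open BipartiteGraph parts

  data E₁ : Left → Right → Set where
    a-b  : E₁ a b
    a-y  : E₁ a y
    a-p  : ∀ k → E₁ a (p k)
    x-y  : E₁ x y
    c-b  : ∀ j → E₁ (c j) b
    q-y  : ∀ k → E₁ (q k) y
    q-lq : ∀ k j → E₁ (q k) (lq k j)
    lp-p : ∀ k j → E₁ (lp k j) (p k)

  data E₂ : Left → Right → Set where
    x-b  : E₂ x b
    x-y  : E₂ x y
    c-b  : ∀ j → E₂ (c j) b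
    q-p  : ∀ k → E₂ (q k) (p k)
    q-lq : ∀ k j → E₂ (q k) (lq k j)
    lp-p : ∀ k j → E₂ (lp k j) (p k)

  E₁? : Decidable E₁
  E₁? a        b         = yes a-b
  E₁? a        y         = yes a-y
  E₁? a        (p k)     = yes (a-p k)
  E₁? a        (lq _ _)  = no λ ()
  E₁? x        b         = no λ ()
  E₁? x        y         = yes x-y
  E₁? x        (p _)     = no λ ()
  E₁? x        (lq _ _)  = no λ ()
  E₁? (c j)    b         = yes (c-b j)
  E₁? (c _)    y         = no λ ()
  E₁? (c _)    (p _)     = no λ ()
  E₁? (c _)    (lq _ _)  = no λ ()
  E₁? (q _)    b         = no λ ()
  E₁? (q k)    y         = yes (q-y k)
  E₁? (q _)    (p _)     = no λ ()
  E₁? (q k)    (lq k′ j) = map′ (λ { refl → q-lq k j }) (λ { (q-lq _ _) → refl }) (k ≟ k′)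
  E₁? (lp _ _) b         = no λ ()
  E₁? (lp _ _) y         = no λ ()
  E₁? (lp k j) (p k′)    = map′ (λ { refl → lp-p k j }) (λ { (lp-p _ _) → refl }) (k ≟ k′)
  E₁? (lp _ _) (lq _ _)  = no λ ()

  E₂? : Decidable E₂
  E₂? a        _         = no λ ()
  E₂? x        b         = yes x-b
  E₂? x        y         = yes x-y
  E₂? x        (p _)     = no λ ()
  E₂? x        (lq _ _)  = no λ ()
  E₂? (c j)    b         = yes (c-b j)
  E₂? (c _)    y         = no λ ()
  E₂? (c _)    (p _)     = no λ ()
  E₂? (c _)    (lq _ _)  = no λ ()
  E₂? (q _)    b         = no λ ()
  E₂? (q _)    y         = no λ ()
  E₂? (q k)    (p k′)    = map′ (λ { refl → q-p k }) (λ { (q-p _) → refl }) (k ≟ k′)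
  E₂? (q k)    (lq k′ j) = map′ (λ { refl → q-lq k j }) (λ { (q-lq _ _) → refl }) (k ≟ k′)
  E₂? (lp _ _) b         = no λ ()
  E₂? (lp _ _) y         = no λ ()
  E₂? (lp k j) (p k′)    = map′ (λ { refl → lp-p k j }) (λ { (lp-p _ _) → refl }) (k ≟ k′)
  E₂? (lp _ _) (lq _ _)  = no λ ()

  G₁ G₂ : Graph n
  G₁ = graph E₁?
  G₂ = graph E₂?

  pathColour : Fin m → Fin Δ
  pathColour k = suc (suc k)

  colour₁ : Left → Right → Fin Δ
  colour₁ a        b        = zero
  colour₁ a        y        = suc zero
  colour₁ a        (p k)    = pathColour k
  colour₁ x        y        = zero
  colour₁ (c j)    b        = suc j
  colour₁ (q k)    y        = pathColour k
  colour₁ (q k)    (lq _ j) = punchIn (pathColour k) j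
  colour₁ (lp k j) (p _)    = punchIn (pathColour k) j
  colour₁ _        _        = zero

  colour₂ : Left → Right → Fin Δ
  colour₂ x     b     = zero
  colour₂ x     y     = suc zero
  colour₂ (q k) (p _) = pathColour k
  colour₂ l     r     = colour₁ l r

  neighbour₁ᴸ : Left → Fin Δ → Right
  neighbour₁ᴸ a        = b ∷ y ∷ p
  neighbour₁ᴸ x        = const y
  neighbour₁ᴸ (c _)    = const b
  neighbour₁ᴸ (q k)    = insertAt (lq k) (pathColour k) y
  neighbour₁ᴸ (lp k _) = const (p k)

  neighbour₁ᴿ : Right → Fin Δ → Left
  neighbour₁ᴿ b        = a ∷ c
  neighbour₁ᴿ y        = x ∷ a ∷ q
  neighbour₁ᴿ (p k)    = insertAt (lp k) (pathColour k) a
  neighbour₁ᴿ (lq k _) = const (q k)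

  neighbour₂ᴸ : Left → Fin Δ → Right
  neighbour₂ᴸ x     = b ∷ const y
  neighbour₂ᴸ (q k) = insertAt (lq k) (pathColour k) (p k)
  neighbour₂ᴸ l     = neighbour₁ᴸ l

  neighbour₂ᴿ : Right → Fin Δ → Left
  neighbour₂ᴿ b     = x ∷ c
  neighbour₂ᴿ y     = const x
  neighbour₂ᴿ (p k) = insertAt (lp k) (pathColour k) (q k)
  neighbour₂ᴿ r     = neighbour₁ᴿ r

  decodes₁ : ∀ {l r} → E₁ l r →
             neighbour₁ᴸ l (colour₁ l r) ≡ r × neighbour₁ᴿ r (colour₁ l r) ≡ l
  decodes₁ a-b        = refl , refl
  decodes₁ a-y        = refl , refl
  decodes₁ (a-p k)    = refl , insertAt-lookup (lp k) (pathColour k) a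
  decodes₁ x-y        = refl , refl
  decodes₁ (c-b j)    = refl , refl
  decodes₁ (q-y k)    = insertAt-lookup (lq k) (pathColour k) y , refl
  decodes₁ (q-lq k j) = insertAt-punchIn (lq k) (pathColour k) y j , refl
  decodes₁ (lp-p k j) = refl , insertAt-punchIn (lp k) (pathColour k) a j

  decodes₂ : ∀ {l r} → E₂ l r →
             neighbour₂ᴸ l (colour₂ l r) ≡ r × neighbour₂ᴿ r (colour₂ l r) ≡ l
  decodes₂ x-b        = refl , refl
  decodes₂ x-y        = refl , refl
  decodes₂ (c-b j)    = refl , refl
  decodes₂ (q-p k)    = insertAt-lookup (lq k) (pathColour k) (p k) ,
                        insertAt-lookup (lp k) (pathColour k) (q k)
  decodes₂ (q-lq k j) = insertAt-punchIn (lq k) (pathColour k) (p k) j , refl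
  decodes₂ (lp-p k j) = refl , insertAt-punchIn (lp k) (pathColour k) (q k) j

  colourable₁ : Colourable G₁ Δ
  colourable₁ = graph-colourable E₁? colour₁ neighbour₁ᴸ neighbour₁ᴿ decodes₁

  colourable₂ : Colourable G₂ Δ
  colourable₂ = graph-colourable E₂? colour₂ neighbour₂ᴸ neighbour₂ᴿ decodes₂

  star₁-b : Star G₁ (right b) Δ
  star₁-b = saturated-star E₁? colour₁ (neighbour₁ᴿ b)
    λ { zero → a-b , refl ; (suc j) → c-b j , refl }

  star₂-b : Star G₂ (right b) Δ
  star₂-b = saturated-star E₂? colour₂ (neighbour₂ᴿ b)
    λ { zero → x-b , refl ; (suc j) → c-b j , refl }

  star₁-y : Star G₁ (right y) Δ
  star₁-y = saturated-star E₁? colour₁ (neighbour₁ᴿ y)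
    λ { zero → x-y , refl ; (suc zero) → a-y , refl ; (suc (suc k)) → q-y k , refl }

  bipartite : Bipartite (G₁ ∪ᴳ G₂)
  bipartite = ∪-bipartite G₁ G₂ side (graph-separates E₁?) (graph-separates E₂?)

  module _ {s} (s<1+Δ : s < suc Δ) (φ : Fin n → Fin n → Fin s)
           (symmetric : ∀ u v → adj (G₁ ∪ᴳ G₂) u v ≡ true → φ u v ≡ φ v u)
           (proper₁ : ProperOn G₁ φ) (proper₂ : ProperOn G₂ φ) where

    symmetric₁ : ∀ {l r} → E₁ l r → φ (left l) (right r) ≡ φ (right r) (left l)
    symmetric₁ e = symmetric _ _ (∪-adjˡ G₁ G₂ (edge E₁? e))

    symmetric₂ : ∀ {l r} → E₂ l r → φ (left l) (right r) ≡ φ (right r) (left l)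
    symmetric₂ e = symmetric _ _ (∪-adjʳ G₁ G₂ (edge E₂? e))

    gadget-b : φ (right b) (left a) ≡ φ (right b) (left x)
    gadget-b = gadget⇒same-colour G₁ G₂ proper₁ proper₂ s<1+Δ
      (left-star E₁? c (λ { refl → refl }) c-b) (edgeʳ E₂? ∘ c-b)
      (edgeʳ E₁? a-b) (edgeʳ E₂? x-b) (λ _ → left-≢ λ ()) (λ _ → left-≢ λ ())

    gadget-p : ∀ k → φ (right (p k)) (left a) ≡ φ (right (p k)) (left (q k))
    gadget-p k = gadget⇒same-colour G₁ G₂ proper₁ proper₂ s<1+Δ
      (left-star E₁? (lp k) (λ { refl → refl }) (lp-p k)) (edgeʳ E₂? ∘ lp-p k)
      (edgeʳ E₁? (a-p k)) (edgeʳ E₂? (q-p k)) (λ _ → left-≢ λ ()) (λ _ → left-≢ λ ())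

    gadget-q : ∀ k → φ (left (q k)) (right y) ≡ φ (left (q k)) (right (p k))
    gadget-q k = gadget⇒same-colour G₁ G₂ proper₁ proper₂ s<1+Δ
      (right-star E₁? (lq k) (λ { refl → refl }) (q-lq k)) (edge E₂? ∘ q-lq k)
      (edge E₁? (q-y k)) (edge E₂? (q-p k)) (λ _ → right-≢ λ ()) (λ _ → right-≢ λ ())

    ab≡xb : φ (left a) (right b) ≡ φ (left x) (right b)
    ab≡xb = begin
      φ (left a) (right b)  ≡⟨ symmetric₁ a-b ⟩
      φ (right b) (left a)  ≡⟨ gadget-b ⟩
      φ (right b) (left x)  ≡⟨ symmetric₂ x-b ⟨
      φ (left x) (right b)  ∎

    ap≡qy : ∀ k → φ (left a) (right (p k)) ≡ φ (left (q k)) (right y)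
    ap≡qy k = begin
      φ (left a) (right (p k))      ≡⟨ symmetric₁ (a-p k) ⟩
      φ (right (p k)) (left a)      ≡⟨ gadget-p k ⟩
      φ (right (p k)) (left (q k))  ≡⟨ symmetric₂ (q-p k) ⟨
      φ (left (q k)) (right (p k))  ≡⟨ gadget-q k ⟨
      φ (left (q k)) (right y)      ∎

    ab-fresh-at-y : ∀ t → φ (left a) (right b) ≢ φ (right y) (leaf star₁-y t)
    ab-fresh-at-y zero eq =
      proper₂ (left x) (right b) (right y) (edge E₂? x-b) (edge E₂? x-y) (right-≢ λ ())
        (trans (sym ab≡xb) (trans eq (sym (symmetric₁ x-y))))
    ab-fresh-at-y (suc zero) eq =
      proper₁ (left a) (right b) (right y) (edge E₁? a-b) (edge E₁? a-y) (right-≢ λ ())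
        (trans eq (sym (symmetric₁ a-y)))
    ab-fresh-at-y (suc (suc k)) eq =
      proper₁ (left a) (right b) (right (p k)) (edge E₁? a-b) (edge E₁? (a-p k)) (right-≢ λ ())
        (trans eq (trans (sym (symmetric₁ (q-y k))) (sym (ap≡qy k))))

    joint-colouring-impossible : ⊥
    joint-colouring-impossible =
      <⇒notInjective s<1+Δ (fresh-∷-injective ab-fresh-at-y (star-colours-injective proper₁ star₁-y))

  no-joint-Δ-colouring : ChromaticIndex₂≥ G₁ G₂ (suc Δ)
  no-joint-Δ-colouring s s<1+Δ (φ , symmetric , proper₁ , proper₂) =
    joint-colouring-impossible s<1+Δ φ symmetric proper₁ proper₂

proposition4p1 : (Δ : ℕ) → 2 ≤ Δ →
    Σ ℕ λ n → Σ (Graph n) λ G₁ → Σ (Graph n) λ G₂ →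
      (maxDegree G₁ ≡ Δ) × ChromaticIndex G₁ Δ ×
      (maxDegree G₂ ≡ Δ) × ChromaticIndex G₂ Δ ×
      Bipartite (G₁ ∪ᴳ G₂) × ChromaticIndex₂≥ G₁ G₂ (suc Δ)
proposition4p1 (suc (suc m)) (s≤s (s≤s z≤n)) =
  n , G₁ , G₂ ,
  colourable∧star⇒maxDegree≡ colourable₁ star₁-b ,
  colourable∧star⇒chromaticIndex colourable₁ star₁-b ,
  colourable∧star⇒maxDegree≡ colourable₂ star₂-b ,
  colourable∧star⇒chromaticIndex colourable₂ star₂-b ,
  bipartite , no-joint-Δ-colouring
  where open Construction m
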